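{- Let $k\ge 1$ and $1\le r\le 4k^2$. Let $\overline{\mathcal{B}}(2k,2k;r)$ be the set of boards in $\mathcal{B}(2k,2k;r)$ whose board partition $(\lambda_1,\lambda_2,\lambda_3,\lambda_4)$ satisfies: (i) $\lambda_1\ge\lambda_i$ for all $i>1$; (ii) $\lambda_2\ge\lambda_4$; (iii) if $\lambda_1=\lambda_2$ then $\lambda_3\ge\lambda_4$. Then: (1) $\overline{\mathcal{B}}(2k,2k;r)$ is the disjoint union of the sets of all boards in $\mathcal{B}(2k,2k;r)$ having a given board partition, over finitely many board partitions; (2) every board in $\mathcal{B}(2k,2k;r)$ is equivalent under $D_4$ to some board in $\overline{\mathcal{B}}(2k,2k;r)$; (3) any two boards in $\overline{\mathcal{B}}(2k,2k;r)$ that are equivalent under $D_4$ have the same board partition.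
   Context: A $2k\times 2k$ grid has cells $(i,j)$, $1\le i,j\le 2k$ ($i$ = row from top, $j$ = column from left). $\mathcal{B}(2k,2k;r)$ is the set of all choices of exactly $r$ blocked cells. $D_4$ acts on cells (hence on boards): rotations $R_0,R_{90},R_{180},R_{270}$ about the center, reflections $H$ (across the horizontal midline), $V$ (across the vertical midline), $D$ (across the main diagonal from top-left to bottom-right) and $D'$ (across the other diagonal). Boards are equivalent under a group if one is an image of the other. The board partition of a board is $(\lambda_1,\lambda_2,\lambda_3,\lambda_4)$, where $\lambda_1,\lambda_2,\lambda_3,\lambda_4$ are the numbers of blocked cells in the upper-left quadrant (rows $1..k$, columns $1..k$), upper-right quadrant (rows $1..k$, columns $k+1..2k$), lower-right quadrant (rows $k+1..2k$, columns $k+1..2k$) and lower-left quadrant (rows $k+1..2k$, columns $1..k$) respectively. -}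

module Defs where

open import Data.Nat using (ℕ; _+_; _*_; _≤_; _<ᵇ_)
open import Data.Bool using (Bool; true; false; _∧_; if_then_else_)
open import Data.Fin using (Fin; toℕ; opposite)
open import Data.List using (List; map)
open import Data.Nat.ListAction using (sum)
open import Data.List using () renaming (allFin to allFinL)
open import Data.Product using (_×_; _,_; Σ; ∃)
open import Relation.Binary.PropositionalEquality using (_≡_)

-- Cells of the 2k × 2k grid: (row, column), 0-indexed (row 0 = top, column 0 = left).
Cell : ℕ → Set
Cell k = Fin (2 * k) × Fin (2 * k)

-- A board: which cells are blocked (true = blocked).
Board : ℕ → Set
Board k = Cell k → Bool

countWhere : (k : ℕ) → (Cell k → Bool) → Board k → ℕ
countWhere k P b =
  sum (map (λ i → sum (map (λ j → if P (i , j) ∧ b (i , j) then 1 else 0)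
                           (allFinL (2 * k))))
           (allFinL (2 * k)))

blocked : (k : ℕ) → Board k → ℕ
blocked k b = countWhere k (λ _ → true) b

InB : (k r : ℕ) → Board k → Set
InB k r b = blocked k b ≡ r

upper left : (k : ℕ) → Fin (2 * k) → Bool
upper k i = toℕ i <ᵇ k
left  k j = toℕ j <ᵇ k

not : Bool → Bool
not true = false
not false = true

Partition : Set
Partition = ℕ × ℕ × ℕ × ℕ

-- board partition (λ1, λ2, λ3, λ4): UL, UR, LR, LL quadrants
partition : (k : ℕ) → Board k → Partition
partition k b =
  countWhere k (λ { (i , j) → upper k i ∧ left k j }) b ,
  countWhere k (λ { (i , j) → upper k i ∧ not (left k j) }) b ,
  countWhere k (λ { (i , j) → not (upper k i) ∧ not (left k j) }) b ,
  countWhere k (λ { (i , j) → not (upper k i) ∧ left k j }) b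

Canonical : Partition → Set
Canonical (l1 , l2 , l3 , l4) =
  (l2 ≤ l1 × l3 ≤ l1 × l4 ≤ l1) × l4 ≤ l2 × (l1 ≡ l2 → l4 ≤ l3)

InBbar : (k r : ℕ) → Board k → Set
InBbar k r b = InB k r b × Canonical (partition k b)

data D4 : Set where
  R0 R90 R180 R270 H V D D' : D4

act : (k : ℕ) → D4 → Cell k → Cell k
act k R0   (i , j) = i , j
act k R90  (i , j) = j , opposite i
act k R180 (i , j) = opposite i , opposite j
act k R270 (i , j) = opposite j , i
act k H    (i , j) = opposite i , j
act k V    (i , j) = i , opposite j
act k D    (i , j) = j , i
act k D'   (i , j) = opposite j , opposite i

-- action on boards: g·b is the board whose blocked cells are the images g(c)
-- of the blocked cells c of b; equivalently (g·b)(g c) = b c.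
-- b' is equivalent to b under D4 iff b' = g·b for some g.
Equiv : (k : ℕ) → Board k → Board k → Set
Equiv k b b' = ∃ λ (g : D4) → ∀ (c : Cell k) → b' (act k g c) ≡ b c

{-# OPTIONS --safe #-}

-- Counting blocked cells is a double sum over the grid, which is invariant under
-- transposition and under reversing the rows or the columns; since every symmetry
-- permutes the four quadrants, it permutes the board partition accordingly, and all
-- three claims become statements about D4 acting on quadruples (λ1, λ2, λ3, λ4).
-- One of R0, D, D', R180 orders both diagonals (λ3 ≤ λ1 and λ4 ≤ λ2), after which
-- either the quadruple or its image under V is canonical. Conversely, if a quadruple
-- and its image under some g are both canonical, antisymmetry of ≤ forces the entries
-- that g moves to be equal. For (1) take the canonical quadruples with entries at most r.

module Submission where

open import Defs
open import Data.Nat using (ℕ; zero; suc; _+_; _*_; _∸_; _≤_; _<ᵇ_; z≤n; s≤s)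
open import Data.Nat.Properties
  using ( ≤-refl; ≤-trans; ≤-antisym; ≤-total; <⇒≤; <⇒≢; +-suc; +-identityʳ; +-mono-≤
        ; +-mono-≤-<; ≮⇒≥; m∸n+n≡m; <-cmp; <ᵇ-reflects-<; +-0-commutativeMonoid; _≤?_; _≟_)
open import Data.Nat.ListAction using (sum)
open import Data.Bool using (Bool; true; false; _∧_; if_then_else_)
open import Data.Bool.Properties using (∧-comm)
open import Data.Fin as Fin using (Fin; toℕ; opposite)
open import Data.Fin.Properties using (opposite-prop; opposite-involutive; toℕ<n)
open import Data.Fin.Permutation using (reverse)
open import Data.List using (List; map; tabulate; allFin; filter; cartesianProduct; upTo)
open import Data.List.Properties using (map-tabulate)
open import Data.List.Membership.Propositional using (_∈_)
open import Data.List.Membership.Propositional.Properties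
  using (∈-filter⁺; ∈-filter⁻; ∈-cartesianProduct⁺; ∈-upTo⁺)
open import Data.List.Relation.Unary.Unique.Propositional using (Unique)
open import Data.List.Relation.Unary.Unique.Propositional.Properties
  using (filter⁺; cartesianProduct⁺; upTo⁺)
open import Data.Product using (_×_; _,_; Σ; ∃; ∃-syntax; proj₂; swap)
open import Data.Sum using (_⊎_; inj₁; inj₂)
open import Function using (_∘_; id)
open import Function.Bundles using (_⇔_; mk⇔)
open import Relation.Nullary using (Dec; contradiction)
open import Relation.Nullary.Decidable using (_×-dec_; _→-dec_)
open import Relation.Nullary.Reflects using (ofʸ; ofⁿ)
open import Relation.Binary using (tri<; tri≈; tri>)
open import Relation.Binary.PropositionalEquality
  using (_≡_; _≗_; refl; sym; trans; cong; cong₂; subst; subst₂; module ≡-Reasoning)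
open import Algebra.Properties.CommutativeMonoid.Sum +-0-commutativeMonoid
  using (sum-syntax; sum-cong-≗; ∑-comm; ∑-permute)

∑-mono-≤ : ∀ {n} {f g : Fin n → ℕ} → (∀ i → f i ≤ g i) → ∑[ i < n ] f i ≤ ∑[ i < n ] g i
∑-mono-≤ {zero}  f≤g = z≤n
∑-mono-≤ {suc n} f≤g = +-mono-≤ (f≤g Fin.zero) (∑-mono-≤ (f≤g ∘ Fin.suc))

∑-opposite : ∀ {n} (f : Fin n → ℕ) → ∑[ i < n ] f (opposite i) ≡ ∑[ i < n ] f i
∑-opposite f = sym (∑-permute f reverse)

sum-tabulate : ∀ {n} (f : Fin n → ℕ) → sum (tabulate f) ≡ ∑[ i < n ] f i
sum-tabulate {zero}  f = refl
sum-tabulate {suc n} f = cong (f Fin.zero +_) (sum-tabulate (f ∘ Fin.suc))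

sum-map-allFin : ∀ {n} (f : Fin n → ℕ) → sum (map f (allFin n)) ≡ ∑[ i < n ] f i
sum-map-allFin f = trans (cong sum (map-tabulate id f)) (sum-tabulate f)

module _ {n : ℕ} where

  ∑∑ : (Fin n × Fin n → ℕ) → ℕ
  ∑∑ F = ∑[ i < n ] ∑[ j < n ] F (i , j)

  ∑∑-cong : ∀ {F G} → F ≗ G → ∑∑ F ≡ ∑∑ G
  ∑∑-cong F≗G = sum-cong-≗ (λ i → sum-cong-≗ (λ j → F≗G (i , j)))

  ∑∑-mono-≤ : ∀ {F G} → (∀ c → F c ≤ G c) → ∑∑ F ≤ ∑∑ G
  ∑∑-mono-≤ F≤G = ∑-mono-≤ (λ i → ∑-mono-≤ (λ j → F≤G (i , j)))

  ∑∑-swap : ∀ F → ∑∑ (F ∘ swap) ≡ ∑∑ F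
  ∑∑-swap F = ∑-comm (λ i j → F (j , i))

  ∑∑-oppositeˡ : ∀ F → ∑∑ (λ (i , j) → F (opposite i , j)) ≡ ∑∑ F
  ∑∑-oppositeˡ F = ∑-opposite (λ i → ∑[ j < n ] F (i , j))

  ∑∑-oppositeʳ : ∀ F → ∑∑ (λ (i , j) → F (i , opposite j)) ≡ ∑∑ F
  ∑∑-oppositeʳ F = sum-cong-≗ (λ i → ∑-opposite (λ j → F (i , j)))

∑∑-act : ∀ k g (F : Cell k → ℕ) → ∑∑ (F ∘ act k g) ≡ ∑∑ F
∑∑-act k R0   F = refl
∑∑-act k R90  F = trans (∑∑-swap (λ (i , j) → F (i , opposite j))) (∑∑-oppositeʳ F)
∑∑-act k R180 F = trans (∑∑-oppositeˡ (λ (i , j) → F (i , opposite j))) (∑∑-oppositeʳ F)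
∑∑-act k R270 F = trans (∑∑-swap (λ (i , j) → F (opposite i , j))) (∑∑-oppositeˡ F)
∑∑-act k H    F = ∑∑-oppositeˡ F
∑∑-act k V    F = ∑∑-oppositeʳ F
∑∑-act k D    F = ∑∑-swap F
∑∑-act k D'   F = trans (∑∑-swap (λ (i , j) → F (opposite i , opposite j))) (∑∑-act k R180 F)

countWhere-∑∑ : ∀ k P (b : Board k) → countWhere k P b ≡ ∑∑ (λ c → if P c ∧ b c then 1 else 0)
countWhere-∑∑ k P b = trans (sum-map-allFin row) (sum-cong-≗ (λ i → sum-map-allFin (λ j → χ (i , j))))
  where
  χ : Cell k → ℕ
  χ c = if P c ∧ b c then 1 else 0
  row : Fin (2 * k) → ℕ
  row i = sum (map (λ j → χ (i , j)) (allFin (2 * k)))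

countWhere-≤-blocked : ∀ k P (b : Board k) → countWhere k P b ≤ blocked k b
countWhere-≤-blocked k P b = subst₂ _≤_ (sym (countWhere-∑∑ k P b)) (sym (countWhere-∑∑ k _ b))
  (∑∑-mono-≤ (λ c → indicator-∧-≤ (P c) (b c)))
  where
  indicator-∧-≤ : ∀ x y → (if x ∧ y then 1 else 0) ≤ (if y then 1 else 0)
  indicator-∧-≤ true  y = ≤-refl
  indicator-∧-≤ false y = z≤n

countWhere-cong : ∀ k {P Q} (b : Board k) → P ≗ Q → countWhere k P b ≡ countWhere k Q b
countWhere-cong k {P} {Q} b P≗Q = begin
  countWhere k P b                        ≡⟨ countWhere-∑∑ k P b ⟩
  ∑∑ (λ c → if P c ∧ b c then 1 else 0)  ≡⟨ ∑∑-cong (λ c → cong (λ x → if x ∧ b c then 1 else 0) (P≗Q c)) ⟩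
  ∑∑ (λ c → if Q c ∧ b c then 1 else 0)  ≡⟨ countWhere-∑∑ k Q b ⟨
  countWhere k Q b                        ∎
  where open ≡-Reasoning

countWhere-act : ∀ k g {b b' : Board k} → (∀ c → b' (act k g c) ≡ b c) →
                 ∀ P → countWhere k P b' ≡ countWhere k (P ∘ act k g) b
countWhere-act k g {b} {b'} b'∘g≗b P = begin
  countWhere k P b'                                               ≡⟨ countWhere-∑∑ k P b' ⟩
  ∑∑ (λ c → if P c ∧ b' c then 1 else 0)                          ≡⟨ ∑∑-act k g _ ⟨
  ∑∑ (λ c → if P (act k g c) ∧ b' (act k g c) then 1 else 0)      ≡⟨ ∑∑-cong (λ c → cong (λ x → if P (act k g c) ∧ x then 1 else 0) (b'∘g≗b c)) ⟩
  ∑∑ (λ c → if P (act k g c) ∧ b c then 1 else 0)                 ≡⟨ countWhere-∑∑ k (P ∘ act k g) b ⟨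
  countWhere k (P ∘ act k g) b                                    ∎
  where open ≡-Reasoning

<ᵇ-complement : ∀ {k x y} → x + suc y ≡ k + k → (x <ᵇ k) ≡ not (y <ᵇ k)
<ᵇ-complement {k} {x} {y} x+y+1≡2k
  with x <ᵇ k | <ᵇ-reflects-< x k | y <ᵇ k | <ᵇ-reflects-< y k
... | true  | ofʸ x<k | true  | ofʸ y<k =
  contradiction (trans (sym (+-suc x y)) x+y+1≡2k) (<⇒≢ (+-mono-≤-< x<k y<k))
... | true  | ofʸ _   | false | ofⁿ _   = refl
... | false | ofⁿ _   | true  | ofʸ _   = refl
... | false | ofⁿ x≮k | false | ofⁿ y≮k =
  contradiction (sym x+y+1≡2k) (<⇒≢ (+-mono-≤-< (≮⇒≥ x≮k) (s≤s (≮⇒≥ y≮k))))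

upper-opposite : ∀ k (i : Fin (2 * k)) → upper k (opposite i) ≡ not (upper k i)
upper-opposite k i = <ᵇ-complement {k} (begin
  toℕ (opposite i) + suc (toℕ i)    ≡⟨ cong (_+ suc (toℕ i)) (opposite-prop i) ⟩
  2 * k ∸ suc (toℕ i) + suc (toℕ i) ≡⟨ m∸n+n≡m (toℕ<n i) ⟩
  k + (k + 0)                       ≡⟨ cong (k +_) (+-identityʳ k) ⟩
  k + k                             ∎)
  where open ≡-Reasoning

Quadrant : Set
Quadrant = Bool × Bool

quadrant : ∀ k → Cell k → Quadrant
quadrant k (i , j) = upper k i , left k j

actQ : D4 → Quadrant → Quadrant
actQ R0   (u , l) = u , l
actQ R90  (u , l) = l , not u
actQ R180 (u , l) = not u , not l
actQ R270 (u , l) = not l , u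
actQ H    (u , l) = not u , l
actQ V    (u , l) = u , not l
actQ D    (u , l) = l , u
actQ D'   (u , l) = not l , not u

quadrant-act : ∀ k g c → quadrant k (act k g c) ≡ actQ g (quadrant k c)
quadrant-act k R0   (i , j) = refl
quadrant-act k R90  (i , j) = cong (left k j ,_) (upper-opposite k i)
quadrant-act k R180 (i , j) = cong₂ _,_ (upper-opposite k i) (upper-opposite k j)
quadrant-act k R270 (i , j) = cong (_, upper k i) (upper-opposite k j)
quadrant-act k H    (i , j) = cong (_, left k j) (upper-opposite k i)
quadrant-act k V    (i , j) = cong (upper k i ,_) (upper-opposite k j)
quadrant-act k D    (i , j) = refl
quadrant-act k D'   (i , j) = cong₂ _,_ (upper-opposite k j) (upper-opposite k i)

-- Matching on the second argument makes sameQuadrant (quadrant k c) q, for a literal q,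
-- reduce to the very predicate used by partition, so partition k b is definitionally
-- toPartition (quadrantCount k b).
_==_ : Bool → Bool → Bool
x == true  = x
x == false = not x

not-==-not : ∀ x y → (not x == not y) ≡ (x == y)
not-==-not true  true  = refl
not-==-not false true  = refl
not-==-not x     false = refl

sameQuadrant : Quadrant → Quadrant → Bool
sameQuadrant (u , l) (u' , l') = (u == u') ∧ (l == l')

sameQuadrant-act : ∀ g x y → sameQuadrant (actQ g x) (actQ g y) ≡ sameQuadrant x y
sameQuadrant-act R0   (u , l) (u' , l') = refl
sameQuadrant-act R90  (u , l) (u' , l') = trans (cong ((l == l') ∧_) (not-==-not u u')) (∧-comm (l == l') _)
sameQuadrant-act R180 (u , l) (u' , l') = cong₂ _∧_ (not-==-not u u') (not-==-not l l')
sameQuadrant-act R270 (u , l) (u' , l') = trans (cong (_∧ (u == u')) (not-==-not l l')) (∧-comm (l == l') _)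
sameQuadrant-act H    (u , l) (u' , l') = cong (_∧ (l == l')) (not-==-not u u')
sameQuadrant-act V    (u , l) (u' , l') = cong ((u == u') ∧_) (not-==-not l l')
sameQuadrant-act D    (u , l) (u' , l') = ∧-comm (l == l') (u == u')
sameQuadrant-act D'   (u , l) (u' , l') =
  trans (cong₂ _∧_ (not-==-not l l') (not-==-not u u')) (∧-comm (l == l') _)

quadrantCount : ∀ k → Board k → Quadrant → ℕ
quadrantCount k b q = countWhere k (λ c → sameQuadrant (quadrant k c) q) b

quadrantCount-act : ∀ k g {b b' : Board k} → (∀ c → b' (act k g c) ≡ b c) →
                    ∀ q → quadrantCount k b' (actQ g q) ≡ quadrantCount k b q
quadrantCount-act k g {b} {b'} b'∘g≗b q = begin
  quadrantCount k b' (actQ g q)                                            ≡⟨ countWhere-act k g b'∘g≗b (λ c → sameQuadrant (quadrant k c) (actQ g q)) ⟩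
  countWhere k (λ c → sameQuadrant (quadrant k (act k g c)) (actQ g q)) b  ≡⟨ countWhere-cong k b (λ c → begin
    sameQuadrant (quadrant k (act k g c)) (actQ g q)  ≡⟨ cong (λ x → sameQuadrant x (actQ g q)) (quadrant-act k g c) ⟩
    sameQuadrant (actQ g (quadrant k c)) (actQ g q)   ≡⟨ sameQuadrant-act g (quadrant k c) q ⟩
    sameQuadrant (quadrant k c) q                     ∎) ⟩
  quadrantCount k b q                                                      ∎
  where open ≡-Reasoning

toPartition : (Quadrant → ℕ) → Partition
toPartition f = f (true , true) , f (true , false) , f (false , false) , f (false , true)

fromPartition : Partition → Quadrant → ℕ
fromPartition (a , b , c , d) (true  , true)  = a
fromPartition (a , b , c , d) (true  , false) = b
fromPartition (a , b , c , d) (false , false) = c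
fromPartition (a , b , c , d) (false , true)  = d

fromPartition-toPartition : ∀ f → fromPartition (toPartition f) ≗ f
fromPartition-toPartition f (true  , true)  = refl
fromPartition-toPartition f (true  , false) = refl
fromPartition-toPartition f (false , false) = refl
fromPartition-toPartition f (false , true)  = refl

toPartition-cong : ∀ {f g} → f ≗ g → toPartition f ≡ toPartition g
toPartition-cong f≗g =
  cong₂ _,_ (f≗g _) (cong₂ _,_ (f≗g _) (cong₂ _,_ (f≗g _) (f≗g _)))

π : D4 → Partition → Partition
π g p = toPartition (fromPartition p ∘ actQ g)

partition-act : ∀ k g {b b' : Board k} → (∀ c → b' (act k g c) ≡ b c) →
                partition k b ≡ π g (partition k b')
partition-act k g {b} {b'} b'∘g≗b = begin
  toPartition (quadrantCount k b)                                ≡⟨ toPartition-cong (quadrantCount-act k g b'∘g≗b) ⟨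
  toPartition (quadrantCount k b' ∘ actQ g)                      ≡⟨ toPartition-cong (fromPartition-toPartition (quadrantCount k b') ∘ actQ g) ⟨
  toPartition (fromPartition (partition k b') ∘ actQ g)          ∎
  where open ≡-Reasoning

blocked-act : ∀ k g {b b' : Board k} → (∀ c → b' (act k g c) ≡ b c) → blocked k b ≡ blocked k b'
blocked-act k g b'∘g≗b = sym (countWhere-act k g b'∘g≗b (λ _ → true))

DiagonalsOrdered : Partition → Set
DiagonalsOrdered (a , b , c , d) = c ≤ a × d ≤ b

order-diagonals : ∀ p → ∃[ g ] DiagonalsOrdered (π g p)
order-diagonals (a , b , c , d) with ≤-total c a | ≤-total d b
... | inj₁ c≤a | inj₁ d≤b = R0   , c≤a , d≤b
... | inj₁ c≤a | inj₂ b≤d = D    , c≤a , b≤d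
... | inj₂ a≤c | inj₁ d≤b = D'   , a≤c , d≤b
... | inj₂ a≤c | inj₂ b≤d = R180 , a≤c , b≤d

canonical⊎V-canonical : ∀ p → DiagonalsOrdered p → Canonical p ⊎ Canonical (π V p)
canonical⊎V-canonical (a , b , c , d) (c≤a , d≤b) with <-cmp a b
... | tri< a<b _ _ = inj₂ ((<⇒≤ a<b , d≤b , ≤-trans c≤a (<⇒≤ a<b)) , c≤a , λ b≡a → contradiction (sym b≡a) (<⇒≢ a<b))
... | tri> _ _ b<a = inj₁ ((<⇒≤ b<a , c≤a , ≤-trans d≤b (<⇒≤ b<a)) , d≤b , λ a≡b → contradiction (sym a≡b) (<⇒≢ b<a))
... | tri≈ _ refl _ with ≤-total d c
...   | inj₁ d≤c = inj₁ ((≤-refl , c≤a , d≤b) , d≤b , λ _ → d≤c)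
...   | inj₂ c≤d = inj₂ ((≤-refl , d≤b , c≤a) , c≤a , λ _ → c≤d)

_∘V : D4 → D4
R0   ∘V = V
R90  ∘V = D'
R180 ∘V = H
R270 ∘V = D
H    ∘V = R180
V    ∘V = R0
D    ∘V = R270
D'   ∘V = R90

π-∘V : ∀ g p → π (g ∘V) p ≡ π V (π g p)
π-∘V R0   p = refl
π-∘V R90  p = refl
π-∘V R180 p = refl
π-∘V R270 p = refl
π-∘V H    p = refl
π-∘V V    p = refl
π-∘V D    p = refl
π-∘V D'   p = refl

canonical-image : ∀ p → ∃[ g ] Canonical (π g p)
canonical-image p with order-diagonals p
... | g , ordered with canonical⊎V-canonical (π g p) ordered
...   | inj₁ canonical = g , canonical
...   | inj₂ canonical = g ∘V , subst Canonical (sym (π-∘V g p)) canonical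

canonical-unique : ∀ g p → Canonical p → Canonical (π g p) → π g p ≡ p
canonical-unique R0 p _ _ = refl
canonical-unique R90 (a , b , c , d) ((b≤a , c≤a , d≤a) , _ , _) ((_ , _ , a≤b) , a≤c , tie)
  with ≤-antisym b≤a a≤b | ≤-antisym c≤a a≤c
... | refl | refl with ≤-antisym d≤a (tie refl)
...   | refl = refl
canonical-unique R180 (a , b , c , d) ((_ , c≤a , _) , d≤b , _) ((_ , a≤c , _) , b≤d , _)
  with ≤-antisym c≤a a≤c | ≤-antisym d≤b b≤d
... | refl | refl = refl
canonical-unique R270 (a , b , c , d) ((_ , _ , d≤a) , d≤b , tie) ((a≤d , b≤d , c≤d) , _ , _)
  with ≤-antisym d≤a a≤d | ≤-antisym d≤b b≤d
... | refl | refl with ≤-antisym (tie refl) c≤d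
...   | refl = refl
canonical-unique H (a , b , c , d) ((_ , c≤a , d≤a) , d≤b , _) ((_ , b≤d , a≤d) , a≤c , _)
  with ≤-antisym d≤a a≤d | ≤-antisym c≤a a≤c | ≤-antisym d≤b b≤d
... | refl | refl | refl = refl
canonical-unique V (a , b , c , d) ((b≤a , _ , _) , _ , tie) ((a≤b , _ , _) , _ , tie')
  with ≤-antisym b≤a a≤b
... | refl with ≤-antisym (tie refl) (tie' refl)
...   | refl = refl
canonical-unique D (a , b , c , d) (_ , d≤b , _) (_ , b≤d , _) with ≤-antisym d≤b b≤d
... | refl = refl
canonical-unique D' (a , b , c , d) ((_ , c≤a , _) , _ , _) ((_ , a≤c , _) , _ , _)
  with ≤-antisym c≤a a≤c
... | refl = refl

inv : D4 → D4
inv R90  = R270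
inv R270 = R90
inv g    = g

act-inv : ∀ k g c → act k g (act k (inv g) c) ≡ c
act-inv k R0   c       = refl
act-inv k R90  (i , j) = cong (i ,_) (opposite-involutive j)
act-inv k R180 (i , j) = cong₂ _,_ (opposite-involutive i) (opposite-involutive j)
act-inv k R270 (i , j) = cong (_, j) (opposite-involutive i)
act-inv k H    (i , j) = cong (_, j) (opposite-involutive i)
act-inv k V    (i , j) = cong (i ,_) (opposite-involutive j)
act-inv k D    c       = refl
act-inv k D'   (i , j) = cong₂ _,_ (opposite-involutive i) (opposite-involutive j)

Canonical? : ∀ p → Dec (Canonical p)
Canonical? (a , b , c , d) =
  ((b ≤? a) ×-dec (c ≤? a) ×-dec (d ≤? a)) ×-dec (d ≤? b) ×-dec ((a ≟ b) →-dec (d ≤? c))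

boundedPartitions : ℕ → List Partition
boundedPartitions n = cartesianProduct xs (cartesianProduct xs (cartesianProduct xs xs))
  where xs = upTo (suc n)

boundedPartitions-unique : ∀ n → Unique (boundedPartitions n)
boundedPartitions-unique n = cartesianProduct⁺ xs (cartesianProduct⁺ xs (cartesianProduct⁺ xs xs))
  where xs = upTo⁺ (suc n)

∈-boundedPartitions : ∀ {n a b c d} → a ≤ n → b ≤ n → c ≤ n → d ≤ n →
                      (a , b , c , d) ∈ boundedPartitions n
∈-boundedPartitions a≤n b≤n c≤n d≤n = ∈-cartesianProduct⁺ (∈-upTo⁺ (s≤s a≤n))
  (∈-cartesianProduct⁺ (∈-upTo⁺ (s≤s b≤n)) (∈-cartesianProduct⁺ (∈-upTo⁺ (s≤s c≤n)) (∈-upTo⁺ (s≤s d≤n))))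

partition-∈-boundedPartitions : ∀ k (b : Board k) → partition k b ∈ boundedPartitions (blocked k b)
partition-∈-boundedPartitions k b = ∈-boundedPartitions
  (countWhere-≤-blocked k _ b) (countWhere-≤-blocked k _ b) (countWhere-≤-blocked k _ b) (countWhere-≤-blocked k _ b)

canonicalPartitions : ℕ → List Partition
canonicalPartitions n = filter Canonical? (boundedPartitions n)

canonicalPartitions-unique : ∀ n → Unique (canonicalPartitions n)
canonicalPartitions-unique n = filter⁺ Canonical? (boundedPartitions-unique n)

InBbar⇔∈-canonicalPartitions : ∀ k r (b : Board k) → InB k r b →
                               InBbar k r b ⇔ partition k b ∈ canonicalPartitions r
InBbar⇔∈-canonicalPartitions k r b b∈B = mk⇔
  (λ (_ , canonical) → ∈-filter⁺ Canonical? (subst (λ n → partition k b ∈ boundedPartitions n) b∈B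
                                                (partition-∈-boundedPartitions k b)) canonical)
  (λ p∈L → b∈B , proj₂ (∈-filter⁻ Canonical? {xs = boundedPartitions r} p∈L))

canonical-representative : ∀ k r (b : Board k) → InB k r b → ∃ λ b' → Equiv k b b' × InBbar k r b'
canonical-representative k r b b∈B with canonical-image (partition k b)
... | g , canonical =
  b ∘ act k g , (inv g , λ c → cong b (act-inv k g c)) , trans (blocked-act k g (λ _ → refl)) b∈B ,
  subst Canonical (sym (partition-act k g (λ _ → refl))) canonical

Equiv-canonical⇒partition-≡ : ∀ k {b b' : Board k} → Equiv k b b' →
  Canonical (partition k b) → Canonical (partition k b') → partition k b ≡ partition k b'
Equiv-canonical⇒partition-≡ k {b} {b'} (g , b'∘g≗b) canonical canonical' = trans b≡gb'
  (canonical-unique g (partition k b') canonical' (subst Canonical b≡gb' canonical))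
  where b≡gb' = partition-act k g b'∘g≗b

theorem4p1 : (k r : ℕ) → 1 ≤ k → 1 ≤ r → r ≤ 4 * (k * k) →
    (Σ (List Partition) λ L → Unique L ×
       (∀ (b : Board k) → InB k r b → (InBbar k r b ⇔ partition k b ∈ L)))
    × (∀ (b : Board k) → InB k r b → ∃ λ (b' : Board k) → Equiv k b b' × InBbar k r b')
    × (∀ (b b' : Board k) → InBbar k r b → InBbar k r b' → Equiv k b b' →
         partition k b ≡ partition k b')
theorem4p1 k r _ _ _ =
  (canonicalPartitions r , canonicalPartitions-unique r , InBbar⇔∈-canonicalPartitions k r) ,
  canonical-representative k r ,
  λ b b' (_ , canonical) (_ , canonical') b~b' →
    Equiv-canonical⇒partition-≡ k {b} {b'} b~b' canonical canonical'
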